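{- There are no games $X,Y$ with $X$ of type $\mathcal Q$, $Y$ of type $\mathcal N$, and $X+Y$ of type $\mathcal P$.
   Context: A (finite impartial) game is defined recursively as a finite set of games, its options; $0$ is the game with no options. Three players alternate moves cyclically; a move replaces the current game by one of its options, and the player who makes the last move wins. The disjunctive sum $G+H$ is the game whose options are all $G'+H$ ($G'$ an option of $G$) and all $G+H'$ ($H'$ an option of $H$). Types are defined recursively: $G$ is of type $\mathcal N$ iff it has some option of type $\mathcal P$; of type $\mathcal O$ iff it has at least one option and all its options are of type $\mathcal N$; of type $\mathcal P$ iff all its options are of type $\mathcal O$ (so $0$ is of type $\mathcal P$); of type $\mathcal Q$ otherwise. -}

module Defs where

open import Data.List using (List; []; _∷_; _++_)
open import Data.Product using (_×_)
open import Data.Sum using (_⊎_)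
open import Relation.Nullary using (¬_)
open import Data.Empty using (⊥)
open import Data.Unit using (⊤)

-- A finite impartial game: given by its (finite) list of options.
-- (Lists model finite sets; order and repetition of options are irrelevant
-- to every notion below.)
data Game : Set where
  node : List Game → Game

options : Game → List Game
options (node gs) = gs

mutual
  _⊕_ : Game → Game → Game
  node gs ⊕ node hs = node (leftOpts gs hs ++ rightOpts gs hs)

  leftOpts : List Game → List Game → List Game
  leftOpts [] hs = []
  leftOpts (g ∷ gs) hs = (g ⊕ node hs) ∷ leftOpts gs hs

  rightOpts : List Game → List Game → List Game
  rightOpts gs [] = []
  rightOpts gs (h ∷ hs) = (node gs ⊕ h) ∷ rightOpts gs hs

mutual
  IsN : Game → Set
  IsN (node gs) = AnyP gs

  IsO : Game → Set
  IsO (node []) = ⊥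
  IsO (node (g ∷ gs)) = AllN (g ∷ gs)

  IsP : Game → Set
  IsP (node gs) = AllO gs

  AnyP : List Game → Set
  AnyP [] = ⊥
  AnyP (g ∷ gs) = IsP g ⊎ AnyP gs

  AllN : List Game → Set
  AllN [] = ⊤
  AllN (g ∷ gs) = IsN g × AllN gs

  AllO : List Game → Set
  AllO [] = ⊤
  AllO (g ∷ gs) = IsO g × AllO gs

IsQ : Game → Set
IsQ G = ¬ IsN G × ¬ IsO G × ¬ IsP G

-- If Y is of type P and X + Y is of type N, P or O, then X is of the same type.  This is
-- proved by simultaneous induction on X and Y together with two companion facts: X + Y of
-- type P with Y of type O, or X + Y of type O with Y of type N, forces X to be of type N.
-- Now if Y is of type N it has an option y of type P, and X + y is an option of the
-- P-position X + Y, hence of type O; so X is of type O, not Q.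
module Submission where

open import Defs
open import Data.Product using (Σ; _×_; _,_; ∃-syntax)
open import Relation.Nullary using (¬_)
open import Data.Sum using (inj₁; inj₂; _⊎_)
open import Function using (_∘_)
open import Data.Empty using (⊥-elim)
open import Data.Unit using (tt)
open import Data.List using (List; []; _∷_; map)
open import Data.List.Membership.Propositional using (_∈_)
open import Data.List.Membership.Propositional.Properties using (∈-map⁺; ∈-map⁻; ∈-++⁺ˡ; ∈-++⁺ʳ; ∈-++⁻)
open import Data.List.Relation.Unary.Any using (here; there)
open import Induction.WellFounded using (Acc; acc; WellFounded)
open import Relation.Binary.PropositionalEquality using (_≡_; refl; sym; cong; cong₂; subst)

private
  variable
    G X Y g : Game
    gs : List Game

infix 4 _≺_

data _≺_ (g : Game) : Game → Set where
  option : g ∈ gs → g ≺ node gs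

option-there : ∀ {h} → g ≺ node gs → g ≺ node (h ∷ gs)
option-there (option m) = option (there m)

P⇒options-O : IsP G → g ≺ G → IsO g
P⇒options-O (o , _)  (option (here refl)) = o
P⇒options-O (_ , os) (option (there m))   = P⇒options-O os (option m)

options-O⇒P : (∀ {g} → g ≺ G → IsO g) → IsP G
options-O⇒P {G = node []}     f = tt
options-O⇒P {G = node (_ ∷ _)} f = f (option (here refl)) , options-O⇒P (f ∘ option-there)

N⇒P-option : IsN G → ∃[ g ] g ≺ G × IsP g
N⇒P-option {G = node (h ∷ _)}  (inj₁ p)  = h , option (here refl) , p
N⇒P-option {G = node (_ ∷ hs)} (inj₂ ps) =
  let g , m , p = N⇒P-option {G = node hs} ps in g , option-there m , p

P-option⇒N : g ≺ G → IsP g → IsN G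
P-option⇒N (option (here refl)) p = inj₁ p
P-option⇒N (option (there m))   p = inj₂ (P-option⇒N (option m) p)

O⇒option : IsO G → ∃[ g ] g ≺ G
O⇒option {G = node (h ∷ _)} _ = h , option (here refl)

O⇒options-N : IsO G → g ≺ G → IsN g
O⇒options-N                         (n , _)  (option (here refl)) = n
O⇒options-N {G = node (_ ∷ _ ∷ _)} (_ , ns) (option (there m))   = O⇒options-N ns (option m)

options-N⇒O : ∀ {h} → (∀ {g} → g ≺ node (h ∷ gs) → IsN g) → IsO (node (h ∷ gs))
options-N⇒O {gs = []}    f = f (option (here refl)) , tt
options-N⇒O {gs = _ ∷ _} f = f (option (here refl)) , options-N⇒O (f ∘ option-there)

leftOpts≡map : ∀ xs ys → leftOpts xs ys ≡ map (_⊕ node ys) xs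
leftOpts≡map []       ys = refl
leftOpts≡map (x ∷ xs) ys = cong (_ ∷_) (leftOpts≡map xs ys)

rightOpts≡map : ∀ xs ys → rightOpts xs ys ≡ map (node xs ⊕_) ys
rightOpts≡map xs []       = refl
rightOpts≡map xs (y ∷ ys) = cong (_ ∷_) (rightOpts≡map xs ys)

≺-⊕⁺ˡ : ∀ {x} X Y → x ≺ X → x ⊕ Y ≺ X ⊕ Y
≺-⊕⁺ˡ (node xs) (node ys) (option m) =
  option (∈-++⁺ˡ (subst (_ ∈_) (sym (leftOpts≡map xs ys)) (∈-map⁺ (_⊕ node ys) m)))

≺-⊕⁺ʳ : ∀ {y} X Y → y ≺ Y → X ⊕ y ≺ X ⊕ Y
≺-⊕⁺ʳ (node xs) (node ys) (option m) =
  option (∈-++⁺ʳ (leftOpts xs ys) (subst (_ ∈_) (sym (rightOpts≡map xs ys)) (∈-map⁺ (node xs ⊕_) m)))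

≺-⊕⁻ : ∀ {o} X Y → o ≺ X ⊕ Y → (∃[ x ] x ≺ X × o ≡ x ⊕ Y) ⊎ (∃[ y ] y ≺ Y × o ≡ X ⊕ y)
≺-⊕⁻ (node xs) (node ys) (option m) with ∈-++⁻ (leftOpts xs ys) m
... | inj₁ l = let x , mx , e = ∈-map⁻ _ (subst (_ ∈_) (leftOpts≡map xs ys) l)
             in inj₁ (x , option mx , e)
... | inj₂ r = let y , my , e = ∈-map⁻ _ (subst (_ ∈_) (rightOpts≡map xs ys) r)
             in inj₂ (y , option my , e)

0ᴳ : Game
0ᴳ = node []

mutual
  ⊕-identityˡ : ∀ Y → 0ᴳ ⊕ Y ≡ Y
  ⊕-identityˡ (node ys) = cong node (rightOpts-identityˡ ys)

  rightOpts-identityˡ : ∀ ys → rightOpts [] ys ≡ ys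
  rightOpts-identityˡ []       = refl
  rightOpts-identityˡ (y ∷ ys) = cong₂ _∷_ (⊕-identityˡ y) (rightOpts-identityˡ ys)

mutual
  ≺-wellFounded : WellFounded _≺_
  ≺-wellFounded (node gs) = acc λ where (option m) → ∈-acc gs m

  ∈-acc : ∀ gs → g ∈ gs → Acc _≺_ g
  ∈-acc (g ∷ _)  (here refl) = ≺-wellFounded g
  ∈-acc (_ ∷ gs) (there m)   = ∈-acc gs m

mutual
  O⇒¬P : Acc _≺_ G → IsO G → ¬ IsP G
  O⇒¬P (acc r) o p = let _ , m = O⇒option o in N⇒¬O (r m) (O⇒options-N o m) (P⇒options-O p m)

  N⇒¬O : Acc _≺_ G → IsN G → ¬ IsO G
  N⇒¬O (acc r) n o = let _ , m , p = N⇒P-option n in P⇒¬N (r m) p (O⇒options-N o m)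

  P⇒¬N : Acc _≺_ G → IsP G → ¬ IsN G
  P⇒¬N (acc r) p n = let _ , m , pg = N⇒P-option n in O⇒¬P (r m) (P⇒options-O p m) pg

mutual
  N-sum-P⇒N : Acc _≺_ X → Acc _≺_ Y → IsN (X ⊕ Y) → IsP Y → IsN X
  N-sum-P⇒N {X} {Y} ax@(acc rx) ay@(acc ry) n pY with N⇒P-option n
  ... | _ , m , p with ≺-⊕⁻ X Y m
  ... | inj₁ (_ , mx , refl) = P-option⇒N mx (P-sum-P⇒P (rx mx) ay p pY)
  ... | inj₂ (_ , my , refl) = P-sum-O⇒N ax (ry my) p (P⇒options-O pY my)

  P-sum-P⇒P : Acc _≺_ X → Acc _≺_ Y → IsP (X ⊕ Y) → IsP Y → IsP X
  P-sum-P⇒P {X} {Y} (acc rx) ay p pY =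
    options-O⇒P λ mx → O-sum-P⇒O (rx mx) ay (P⇒options-O p (≺-⊕⁺ˡ X Y mx)) pY

  O-sum-P⇒O : Acc _≺_ X → Acc _≺_ Y → IsO (X ⊕ Y) → IsP Y → IsO X
  O-sum-P⇒O {node []} {Y} _ ay o pY = ⊥-elim (O⇒¬P ay (subst IsO (⊕-identityˡ Y) o) pY)
  O-sum-P⇒O {X@(node (_ ∷ _))} {Y} (acc rx) ay o pY =
    options-N⇒O λ mx → N-sum-P⇒N (rx mx) ay (O⇒options-N o (≺-⊕⁺ˡ X Y mx)) pY

  P-sum-O⇒N : Acc _≺_ X → Acc _≺_ Y → IsP (X ⊕ Y) → IsO Y → IsN X
  P-sum-O⇒N {X} {Y} ax (acc ry) p oY =
    let _ , my = O⇒option oY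
    in O-sum-N⇒N ax (ry my) (P⇒options-O p (≺-⊕⁺ʳ X Y my)) (O⇒options-N oY my)

  O-sum-N⇒N : Acc _≺_ X → Acc _≺_ Y → IsO (X ⊕ Y) → IsN Y → IsN X
  O-sum-N⇒N {X} {Y} ax (acc ry) o nY =
    let _ , my , py = N⇒P-option nY
    in N-sum-P⇒N ax (ry my) (O⇒options-N o (≺-⊕⁺ʳ X Y my)) py

claim5 : ¬ (Σ Game λ X → Σ Game λ Y → IsQ X × IsN Y × IsP (X ⊕ Y))
claim5 (X , Y , (_ , ¬O , _) , nY , p) =
  let y , my , py = N⇒P-option nY
  in ¬O (O-sum-P⇒O (≺-wellFounded X) (≺-wellFounded y) (P⇒options-O p (≺-⊕⁺ʳ X Y my)) py)
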